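{- (1) $\Delta(f(h^\omega(0)))=\xi^\omega(0)$; and (2) $\Delta(f(g(h^\omega(0))))=\eta(\xi^\omega(0))$.
   Context: $\Sigma_k=\{0,1,\dots,k-1\}$. Morphisms: $f:\Sigma_3^*\to\Sigma_2^*$, $f(0)=0$, $f(1)=01$, $f(2)=011$; $g,h:\Sigma_3^*\to\Sigma_3^*$, $g(0)=011$, $g(1)=0121$, $g(2)=012121$, $h(0)=01$, $h(1)=02$, $h(2)=022$; $\xi,\eta:\Sigma_2^*\to\Sigma_2^*$, $\xi(0)=011$, $\xi(1)=01$, $\eta(0)=011$, $\eta(1)=1$. For a morphism $\sigma$ with $\sigma(0)$ beginning with $0$, $\sigma^\omega(0)$ denotes the infinite fixed point $\lim_n\sigma^n(0)$. For an infinite binary word $x=(x_n)_{n\ge0}$, $\Delta(x)=((x_n+x_{n+1})\bmod 2)_{n\ge0}$. -}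

module Defs where

open import Data.Nat using (ℕ; zero; suc)
open import Data.Fin using (Fin; zero; suc)
open import Data.List using (List; []; _∷_; concatMap; applyUpTo)
open import Function using (_∘_)

Σ : ℕ → Set
Σ k = Fin k

Word : ℕ → Set
Word k = List (Σ k)

InfWord : ℕ → Set
InfWord k = ℕ → Σ k

Morphism : ℕ → ℕ → Set
Morphism k m = Σ k → Word m

apply : ∀ {k m} → Morphism k m → Word k → Word m
apply σ = concatMap σ

iter : ∀ {k} → ℕ → Morphism k k → Word k → Word k
iter zero    σ w = w
iter (suc n) σ w = apply σ (iter n σ w)

-- n-th letter of a finite word (default letter 0 if out of range; never
-- used out of range below)
nth : ∀ {k} → Word (suc k) → ℕ → Σ (suc k)
nth []       _       = zero
nth (a ∷ w) zero    = a
nth (a ∷ w) (suc n) = nth w n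

prefix : ∀ {k} → InfWord k → ℕ → Word k
prefix x n = applyUpTo x n

-- image of an infinite word under a non-erasing morphism:
-- the n-th letter of σ(x) is the n-th letter of σ(x_0 ... x_n)
-- (valid since |σ(x_0...x_n)| ≥ n+1 for non-erasing σ)
applyω : ∀ {k m} → Morphism k (suc m) → InfWord k → InfWord (suc m)
applyω σ x n = nth (apply σ (prefix x (suc n))) n

-- σ^ω(0) = lim σ^n(0), for σ(0) beginning with 0 and |σ(0)| ≥ 2 with σ
-- non-erasing: σ^n(0) is a prefix of σ^{n+1}(0) of length ≥ n+1, so the
-- n-th letter of the limit is the n-th letter of σ^{n+1}(0).
fixω : ∀ {k} → Morphism (suc k) (suc k) → InfWord (suc k)
fixω σ n = nth (iter (suc n) σ (zero ∷ [])) n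

_⊕_ : Σ 2 → Σ 2 → Σ 2
zero     ⊕ b        = b
suc zero ⊕ zero     = suc zero
suc zero ⊕ suc zero = zero

Δ : InfWord 2 → InfWord 2
Δ x n = x n ⊕ x (suc n)

_≋_ : ∀ {k} → InfWord k → InfWord k → Set
x ≋ y = ∀ n → x n ≡ y n
  where open import Relation.Binary.PropositionalEquality using (_≡_)

l0 : ∀ {k} → Σ (suc k)
l0 = zero
l1 : ∀ {k} → Σ (suc (suc k))
l1 = suc zero
l2 : ∀ {k} → Σ (suc (suc (suc k)))
l2 = suc (suc zero)

f : Morphism 3 2
f zero             = l0 ∷ []
f (suc zero)       = l0 ∷ l1 ∷ []
f (suc (suc zero)) = l0 ∷ l1 ∷ l1 ∷ []

g : Morphism 3 3
g zero             = l0 ∷ l1 ∷ l1 ∷ []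
g (suc zero)       = l0 ∷ l1 ∷ l2 ∷ l1 ∷ []
g (suc (suc zero)) = l0 ∷ l1 ∷ l2 ∷ l1 ∷ l2 ∷ l1 ∷ []

h : Morphism 3 3
h zero             = l0 ∷ l1 ∷ []
h (suc zero)       = l0 ∷ l2 ∷ []
h (suc (suc zero)) = l0 ∷ l2 ∷ l2 ∷ []

ξ : Morphism 2 2
ξ zero       = l0 ∷ l1 ∷ l1 ∷ []
ξ (suc zero) = l0 ∷ l1 ∷ []

η : Morphism 2 2
η zero       = l0 ∷ l1 ∷ l1 ∷ []
η (suc zero) = l1 ∷ []

-- Let d be the morphism 0 ↦ 0, 1 ↦ 11, 2 ↦ 101, so that d(a) = Δ(f(a)0). Every block f(a)
-- starts with 0, so Δ(f(w)0) = d(w) for every finite word w; hence d(w) is a prefix of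
-- Δ(f(x)) whenever w is a prefix of x. Letterwise d ∘ h = ξ ∘ d and d ∘ g = η ∘ d ∘ h, so d
-- maps the prefixes hⁿ(0) of h^ω(0) to the prefixes ξⁿ(0) of ξ^ω(0), and g(hⁿ(0)) to
-- η(ξⁿ⁺¹(0)). Two infinite words with arbitrarily long common prefixes are equal.
module Submission where

open import Defs
open import Data.Product using (_×_; _,_; ∃-syntax)
open import Data.Sum using (inj₁; inj₂)
open import Data.Nat using (ℕ; zero; suc; _+_; _≤_; _<_; _≤′_; ≤′-refl; ≤′-step; z≤n; s≤s)
open import Data.Nat.Properties
  using (≤-total; ≤-refl; ≤-trans; ≤-reflexive; <-trans; <-≤-trans; n<1+n; +-comm; +-mono-≤; ≤⇒≤′; module ≤-Reasoning)
open import Data.Fin using (zero; suc)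
open import Data.List using ([]; _∷_; _++_; length)
open import Data.List.Properties
  using (++-assoc; ++-identityʳ; length-++; length-++-≤ˡ; concatMap-++; concatMap-cong; length-applyUpTo; applyUpTo-∷ʳ)
open import Function using (_∘_)
open import Relation.Binary.PropositionalEquality
  using (_≡_; refl; sym; trans; cong; cong₂; subst; _≗_; module ≡-Reasoning)

private
  variable
    k m p q : ℕ

infix 4 _⊑_ _⊑ω_

_⊑_ : Word k → Word k → Set
u ⊑ v = ∃[ t ] u ++ t ≡ v

⊑-refl : {u : Word k} → u ⊑ u
⊑-refl {u = u} = [] , ++-identityʳ u

⊑-trans : {u v w : Word k} → u ⊑ v → v ⊑ w → u ⊑ w
⊑-trans {u = u} (t , refl) (s , refl) = t ++ s , sym (++-assoc u t s)

++⁺-⊑ : (u : Word k) {v v′ : Word k} → v ⊑ v′ → u ++ v ⊑ u ++ v′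
++⁺-⊑ u {v} (t , refl) = t , ++-assoc u v t

⊑-chain : (W : ℕ → Word k) → (∀ n → W n ⊑ W (suc n)) → ∀ {m n} → m ≤′ n → W m ⊑ W n
⊑-chain W step ≤′-refl         = ⊑-refl
⊑-chain W step (≤′-step m≤′n) = ⊑-trans (⊑-chain W step m≤′n) (step _)

nth-++ : (u t : Word (suc k)) {i : ℕ} → i < length u → nth (u ++ t) i ≡ nth u i
nth-++ (a ∷ u) t {zero}  _         = refl
nth-++ (a ∷ u) t {suc i} (s≤s i<u) = nth-++ u t i<u

nth-⊑ : {u v : Word (suc k)} → u ⊑ v → {i : ℕ} → i < length u → nth u i ≡ nth v i
nth-⊑ {u = u} (t , refl) i<u = sym (nth-++ u t i<u)

NonErasing : Morphism k m → Set
NonErasing σ = ∀ a → 0 < length (σ a)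

_⊙_ : Morphism m p → Morphism k m → Morphism k p
(σ ⊙ τ) a = apply σ (τ a)

apply-⊙ : (σ : Morphism m p) (τ : Morphism k m) → ∀ w → apply (σ ⊙ τ) w ≡ apply σ (apply τ w)
apply-⊙ σ τ []      = refl
apply-⊙ σ τ (a ∷ w) = begin
  apply σ (τ a) ++ apply (σ ⊙ τ) w     ≡⟨ cong (apply σ (τ a) ++_) (apply-⊙ σ τ w) ⟩
  apply σ (τ a) ++ apply σ (apply τ w) ≡⟨ concatMap-++ σ (τ a) (apply τ w) ⟨
  apply σ (τ a ++ apply τ w)           ∎
  where open ≡-Reasoning

apply-apply-≗ : (σ : Morphism m p) (τ : Morphism k m) (ρ : Morphism q p) (κ : Morphism k q) →
                σ ⊙ τ ≗ ρ ⊙ κ → ∀ w → apply σ (apply τ w) ≡ apply ρ (apply κ w)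
apply-apply-≗ σ τ ρ κ eq w = begin
  apply σ (apply τ w) ≡⟨ apply-⊙ σ τ w ⟨
  apply (σ ⊙ τ) w     ≡⟨ concatMap-cong eq w ⟩
  apply (ρ ⊙ κ) w     ≡⟨ apply-⊙ ρ κ w ⟩
  apply ρ (apply κ w) ∎
  where open ≡-Reasoning

apply-⊑ : (σ : Morphism k m) {u v : Word k} → u ⊑ v → apply σ u ⊑ apply σ v
apply-⊑ σ {u} (t , refl) = apply σ t , sym (concatMap-++ σ u t)

length-apply : {σ : Morphism k m} → NonErasing σ → ∀ w → length w ≤ length (apply σ w)
length-apply         ne []      = z≤n
length-apply {σ = σ} ne (a ∷ w) =
  ≤-trans (+-mono-≤ (ne a) (length-apply ne w)) (≤-reflexive (sym (length-++ (σ a))))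

iter-suc : ∀ n (σ : Morphism k k) w → iter (suc n) σ w ≡ iter n σ (apply σ w)
iter-suc zero    σ w = refl
iter-suc (suc n) σ w = cong (apply σ) (iter-suc n σ w)

iter-++ : ∀ n (σ : Morphism k k) u v → iter n σ (u ++ v) ≡ iter n σ u ++ iter n σ v
iter-++ zero    σ u v = refl
iter-++ (suc n) σ u v = trans (cong (apply σ) (iter-++ n σ u v)) (concatMap-++ σ (iter n σ u) (iter n σ v))

length-iter : {σ : Morphism k k} → NonErasing σ → ∀ n w → length w ≤ length (iter n σ w)
length-iter ne zero    w = ≤-refl
length-iter ne (suc n) w = ≤-trans (length-iter ne n w) (length-apply ne (iter n _ w))

record _⊑ω_ (w : Word (suc k)) (x : InfWord (suc k)) : Set where
  constructor mk⊑ω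
  field nth-⊑ω : ∀ i → i < length w → nth w i ≡ x i
open _⊑ω_

⊑ω-∷⁻ : ∀ {a} {w : Word (suc k)} {x} → a ∷ w ⊑ω x → w ⊑ω x ∘ suc
nth-⊑ω (⊑ω-∷⁻ aw⊑x) i i<w = nth-⊑ω aw⊑x (suc i) (s≤s i<w)

⊑-⊑ω : {u v : Word (suc k)} {x : InfWord (suc k)} → u ⊑ v → v ⊑ω x → u ⊑ω x
nth-⊑ω (⊑-⊑ω {u = u} (t , refl) v⊑x) i i<u =
  trans (sym (nth-++ u t i<u)) (nth-⊑ω v⊑x i (<-≤-trans i<u (length-++-≤ˡ u)))

⊑ω-extend : {w : Word (suc k)} {x : InfWord (suc k)} → w ⊑ω x → w ++ x (length w) ∷ [] ⊑ω x
nth-⊑ω (⊑ω-extend {w = []}    w⊑x) zero    _         = refl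
nth-⊑ω (⊑ω-extend {w = []}    w⊑x) (suc i) (s≤s ())
nth-⊑ω (⊑ω-extend {w = a ∷ w} w⊑x) zero    _         = nth-⊑ω w⊑x zero (s≤s z≤n)
nth-⊑ω (⊑ω-extend {w = a ∷ w} w⊑x) (suc i) (s≤s i<w) = nth-⊑ω (⊑ω-extend (⊑ω-∷⁻ w⊑x)) i i<w

⊑ω⇒prefix : {w : Word (suc k)} {x : InfWord (suc k)} → w ⊑ω x → prefix x (length w) ≡ w
⊑ω⇒prefix {w = []}    w⊑x = refl
⊑ω⇒prefix {w = a ∷ w} w⊑x = cong₂ _∷_ (sym (nth-⊑ω w⊑x zero (s≤s z≤n))) (⊑ω⇒prefix (⊑ω-∷⁻ w⊑x))

≋-from-⊑ω : {x y : InfWord (suc k)} (W : ℕ → Word (suc k)) → (∀ n → n < length (W n)) →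
            (∀ n → W n ⊑ω x) → (∀ n → W n ⊑ω y) → x ≋ y
≋-from-⊑ω W len W⊑x W⊑y n = trans (sym (nth-⊑ω (W⊑x n) n (len n))) (nth-⊑ω (W⊑y n) n (len n))

-- fixω σ and applyω σ x are definitionally limits of increasing chains of words.
lim : (ℕ → Word (suc k)) → InfWord (suc k)
lim W i = nth (W (suc i)) i

⊑ω-lim : (W : ℕ → Word (suc k)) → (∀ n → W n ⊑ W (suc n)) → (∀ n → n < length (W (suc n))) →
         ∀ n → W n ⊑ω lim W
nth-⊑ω (⊑ω-lim W step len n) i i<W with ≤-total n (suc i)
... | inj₁ n≤ = nth-⊑ (⊑-chain W step (≤⇒≤′ n≤)) i<W
... | inj₂ ≤n = sym (nth-⊑ (⊑-chain W step (≤⇒≤′ ≤n)) (len i))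

applyω-⊑ω : {σ : Morphism (suc k) (suc m)} → NonErasing σ → {w : Word (suc k)} {x : InfWord (suc k)} →
            w ⊑ω x → apply σ w ⊑ω applyω σ x
applyω-⊑ω {σ = σ} ne {w} {x} w⊑x =
  subst (λ v → apply σ v ⊑ω applyω σ x) (⊑ω⇒prefix w⊑x) (⊑ω-lim (apply σ ∘ prefix x) step len (length w))
  where
  step : ∀ n → apply σ (prefix x n) ⊑ apply σ (prefix x (suc n))
  step n = apply-⊑ σ (x n ∷ [] , applyUpTo-∷ʳ x n)
  len : ∀ n → n < length (apply σ (prefix x (suc n)))
  len n = ≤-trans (≤-reflexive (sym (length-applyUpTo x (suc n)))) (length-apply {σ = σ} ne (prefix x (suc n)))

module FixedPoint (σ : Morphism (suc k) (suc k)) (ne : NonErasing σ) {c : Σ (suc k)} {t : Word (suc k)} (σ0≡ : σ zero ≡ zero ∷ c ∷ t) where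

  iter-suc-[0] : ∀ n → iter (suc n) σ (zero ∷ []) ≡ iter n σ (zero ∷ []) ++ iter n σ (c ∷ t)
  iter-suc-[0] n = begin
    iter (suc n) σ (zero ∷ [])           ≡⟨ iter-suc n σ (zero ∷ []) ⟩
    iter n σ (σ zero ++ [])              ≡⟨ cong (iter n σ) (trans (++-identityʳ (σ zero)) σ0≡) ⟩
    iter n σ ((zero ∷ []) ++ c ∷ t)      ≡⟨ iter-++ n σ (zero ∷ []) (c ∷ t) ⟩
    iter n σ (zero ∷ []) ++ iter n σ (c ∷ t) ∎
    where open ≡-Reasoning

  length-iter-[0] : ∀ n → n < length (iter n σ (zero ∷ []))
  length-iter-[0] zero    = s≤s z≤n
  length-iter-[0] (suc n) = begin
    suc (suc n)                                                  ≡⟨ +-comm 1 (suc n) ⟩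
    suc n + 1                                                    ≤⟨ +-mono-≤ (length-iter-[0] n) (≤-trans (s≤s z≤n) (length-iter ne n (c ∷ t))) ⟩
    length (iter n σ (zero ∷ [])) + length (iter n σ (c ∷ t))    ≡⟨ length-++ (iter n σ (zero ∷ [])) ⟨
    length (iter n σ (zero ∷ []) ++ iter n σ (c ∷ t))            ≡⟨ cong length (iter-suc-[0] n) ⟨
    length (iter (suc n) σ (zero ∷ []))                          ∎
    where open ≤-Reasoning

  iter-⊑ω-fixω : ∀ n → iter n σ (zero ∷ []) ⊑ω fixω σ
  iter-⊑ω-fixω = ⊑ω-lim (λ n → iter n σ (zero ∷ []))
                        (λ n → iter n σ (c ∷ t) , sym (iter-suc-[0] n))
                        (λ n → <-trans (n<1+n n) (length-iter-[0] (suc n)))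

Δ′ : Word 2 → Word 2
Δ′ (a ∷ b ∷ w) = (a ⊕ b) ∷ Δ′ (b ∷ w)
Δ′ _           = []

Δ′-++-∷ : ∀ u b r → Δ′ (u ++ b ∷ r) ≡ Δ′ (u ++ b ∷ []) ++ Δ′ (b ∷ r)
Δ′-++-∷ []           b r = refl
Δ′-++-∷ (a ∷ [])     b r = refl
Δ′-++-∷ (a ∷ a′ ∷ u) b r = cong ((a ⊕ a′) ∷_) (Δ′-++-∷ (a′ ∷ u) b r)

Δ′-⊑ω : {w : Word 2} {x : InfWord 2} → w ⊑ω x → Δ′ w ⊑ω Δ x
nth-⊑ω (Δ′-⊑ω {w = a ∷ b ∷ w} w⊑x) zero    _         =
  cong₂ _⊕_ (nth-⊑ω w⊑x 0 (s≤s z≤n)) (nth-⊑ω w⊑x 1 (s≤s (s≤s z≤n)))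
nth-⊑ω (Δ′-⊑ω {w = a ∷ b ∷ w} w⊑x) (suc i) (s≤s i<w) = nth-⊑ω (Δ′-⊑ω (⊑ω-∷⁻ w⊑x)) i i<w

d : Morphism 3 2
d zero             = l0 ∷ []
d (suc zero)       = l1 ∷ l1 ∷ []
d (suc (suc zero)) = l1 ∷ l0 ∷ l1 ∷ []

f-nonErasing : NonErasing f
f-nonErasing zero             = s≤s z≤n
f-nonErasing (suc zero)       = s≤s z≤n
f-nonErasing (suc (suc zero)) = s≤s z≤n

g-nonErasing : NonErasing g
g-nonErasing zero             = s≤s z≤n
g-nonErasing (suc zero)       = s≤s z≤n
g-nonErasing (suc (suc zero)) = s≤s z≤n

h-nonErasing : NonErasing h
h-nonErasing zero             = s≤s z≤n
h-nonErasing (suc zero)       = s≤s z≤n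
h-nonErasing (suc (suc zero)) = s≤s z≤n

ξ-nonErasing : NonErasing ξ
ξ-nonErasing zero       = s≤s z≤n
ξ-nonErasing (suc zero) = s≤s z≤n

η-nonErasing : NonErasing η
η-nonErasing zero       = s≤s z≤n
η-nonErasing (suc zero) = s≤s z≤n

d⊙h≗ξ⊙d : d ⊙ h ≗ ξ ⊙ d
d⊙h≗ξ⊙d zero             = refl
d⊙h≗ξ⊙d (suc zero)       = refl
d⊙h≗ξ⊙d (suc (suc zero)) = refl

d⊙g≗η⊙d⊙h : d ⊙ g ≗ η ⊙ (d ⊙ h)
d⊙g≗η⊙d⊙h zero             = refl
d⊙g≗η⊙d⊙h (suc zero)       = refl
d⊙g≗η⊙d⊙h (suc (suc zero)) = refl

Δ′-f-letter : ∀ a → Δ′ (f a ++ l0 ∷ []) ≡ d a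
Δ′-f-letter zero             = refl
Δ′-f-letter (suc zero)       = refl
Δ′-f-letter (suc (suc zero)) = refl

apply-f-++-0 : ∀ w → ∃[ r ] apply f w ++ l0 ∷ [] ≡ l0 ∷ r
apply-f-++-0 []                   = [] , refl
apply-f-++-0 (zero ∷ w)           = _ , refl
apply-f-++-0 (suc zero ∷ w)       = _ , refl
apply-f-++-0 (suc (suc zero) ∷ w) = _ , refl

Δ′-f : ∀ w → Δ′ (apply f w ++ l0 ∷ []) ≡ apply d w
Δ′-f []      = refl
Δ′-f (a ∷ w) with apply-f-++-0 w
... | r , r≡ = begin
  Δ′ ((f a ++ apply f w) ++ l0 ∷ [])        ≡⟨ cong Δ′ (++-assoc (f a) (apply f w) (l0 ∷ [])) ⟩
  Δ′ (f a ++ apply f w ++ l0 ∷ [])          ≡⟨ cong (Δ′ ∘ (f a ++_)) r≡ ⟩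
  Δ′ (f a ++ l0 ∷ r)                        ≡⟨ Δ′-++-∷ (f a) l0 r ⟩
  Δ′ (f a ++ l0 ∷ []) ++ Δ′ (l0 ∷ r)        ≡⟨ cong₂ _++_ (Δ′-f-letter a) (cong Δ′ (sym r≡)) ⟩
  d a ++ Δ′ (apply f w ++ l0 ∷ [])          ≡⟨ cong (d a ++_) (Δ′-f w) ⟩
  d a ++ apply d w                          ∎
  where open ≡-Reasoning

[0]⊑apply-f : ∀ b → l0 ∷ [] ⊑ apply f (b ∷ [])
[0]⊑apply-f zero             = _ , refl
[0]⊑apply-f (suc zero)       = _ , refl
[0]⊑apply-f (suc (suc zero)) = _ , refl

Δ-applyω-f : {w : Word 3} {x : InfWord 3} → w ⊑ω x → apply d w ⊑ω Δ (applyω f x)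
Δ-applyω-f {w} {x} w⊑x = subst (_⊑ω Δ (applyω f x)) (Δ′-f w) (Δ′-⊑ω (⊑-⊑ω f[w]0⊑ f[wb]⊑))
  where
  b : Σ 3
  b = x (length w)
  f[wb]⊑ : apply f (w ++ b ∷ []) ⊑ω applyω f x
  f[wb]⊑ = applyω-⊑ω f-nonErasing (⊑ω-extend w⊑x)
  f[w]0⊑ : apply f w ++ l0 ∷ [] ⊑ apply f (w ++ b ∷ [])
  f[w]0⊑ = subst (apply f w ++ l0 ∷ [] ⊑_) (sym (concatMap-++ f w (b ∷ []))) (++⁺-⊑ (apply f w) ([0]⊑apply-f b))

apply-d-h : ∀ w → apply d (apply h w) ≡ apply ξ (apply d w)
apply-d-h = apply-apply-≗ d h ξ d d⊙h≗ξ⊙d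

apply-d-iter-h : ∀ n w → apply d (iter n h w) ≡ iter n ξ (apply d w)
apply-d-iter-h zero    w = refl
apply-d-iter-h (suc n) w = trans (apply-d-h (iter n h w)) (cong (apply ξ) (apply-d-iter-h n w))

apply-d-g : ∀ w → apply d (apply g w) ≡ apply η (apply d (apply h w))
apply-d-g w = trans (apply-apply-≗ d g η (d ⊙ h) d⊙g≗η⊙d⊙h w) (cong (apply η) (apply-⊙ d h w))

module H = FixedPoint h h-nonErasing refl
module Ξ = FixedPoint ξ ξ-nonErasing refl

lemma14 : (Δ (applyω f (fixω h)) ≋ fixω ξ)
          × (Δ (applyω f (applyω g (fixω h))) ≋ applyω η (fixω ξ))
lemma14 = ≋-from-⊑ω ξⁿ0 Ξ.length-iter-[0] ξⁿ0⊑Δfu Ξ.iter-⊑ω-fixω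
        , ≋-from-⊑ω (apply η ∘ ξⁿ0 ∘ suc) ηξⁿ⁺¹0-long ηξⁿ⁺¹0⊑Δfgu ηξⁿ⁺¹0⊑ηξω
  where
  hⁿ0 : ℕ → Word 3
  hⁿ0 n = iter n h (l0 ∷ [])

  ξⁿ0 : ℕ → Word 2
  ξⁿ0 n = iter n ξ (l0 ∷ [])

  ξⁿ0⊑Δfu : ∀ n → ξⁿ0 n ⊑ω Δ (applyω f (fixω h))
  ξⁿ0⊑Δfu n = subst (_⊑ω _) (apply-d-iter-h n (l0 ∷ [])) (Δ-applyω-f (H.iter-⊑ω-fixω n))

  ηξⁿ⁺¹0⊑Δfgu : ∀ n → apply η (ξⁿ0 (suc n)) ⊑ω Δ (applyω f (applyω g (fixω h)))
  ηξⁿ⁺¹0⊑Δfgu n = subst (_⊑ω _) (trans (apply-d-g (hⁿ0 n)) (cong (apply η) (apply-d-iter-h (suc n) (l0 ∷ []))))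
                        (Δ-applyω-f (applyω-⊑ω g-nonErasing (H.iter-⊑ω-fixω n)))

  ηξⁿ⁺¹0⊑ηξω : ∀ n → apply η (ξⁿ0 (suc n)) ⊑ω applyω η (fixω ξ)
  ηξⁿ⁺¹0⊑ηξω n = applyω-⊑ω η-nonErasing (Ξ.iter-⊑ω-fixω (suc n))

  ηξⁿ⁺¹0-long : ∀ n → n < length (apply η (ξⁿ0 (suc n)))
  ηξⁿ⁺¹0-long n = <-≤-trans (<-trans (n<1+n n) (Ξ.length-iter-[0] (suc n))) (length-apply η-nonErasing (ξⁿ0 (suc n)))
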